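{- Let $\mathsf{C}$ be a symmetric monoidal closed category and $Q:\mathsf{C}\to\mathsf{Pos}$ a functor equipped with $u\in Q(I)$ and maps $\mu_{X,Y}$ as below, such that $Q$ monoidally factors through $\mathsf{SLatt}$. Then $\int Q$ (with tensor $(X,x)\otimes(Y,y)=(X\otimes Y,\mu_{X,Y}(x,y))$ and unit $(I,u)$) is symmetric monoidal closed and the projection $\pi:\int Q\to\mathsf{C}$ strictly preserves this structure (the internal hom of $\int Q$ lifts $\multimap$ and its unit and counit project to those of $\mathsf{C}$).
   Context: $(\mathsf{C},\otimes,I,a,\lambda,\rho,\sigma)$ is symmetric monoidal closed with internal hom $\multimap$. The total category $\int Q$ has objects $(X,x)$ with $x\in Q(X)$, arrows $f:(X,x)\to(Y,y)$ those $f:X\to Y$ with $Q(f)(x)\le y$; $\pi$ is the projection. $u\in Q(I)$ and $\mu_{X,Y}:Q(X)\times Q(Y)\to Q(X\otimes Y)$ satisfy $Q(\lambda_Y)(\mu_{I,Y}(u,y))=y$, $Q(\rho_X)(\mu_{X,I}(x,u))=x$, $Q(a_{X,Y,Z})(\mu_{X\otimes Y,Z}(\mu_{X,Y}(x,y),z))=\mu_{X,Y\otimes Z}(x,\mu_{Y,Z}(y,z))$, $Q(\sigma_{X,Y})(\mu_{X,Y}(x,y))=\mu_{Y,X}(y,x)$. "$Q$ monoidally factors through $\mathsf{SLatt}$" means: each $Q(X)$ is a complete lattice, each $Q(f)$ preserves all suprema, and $\mu$ is natural ($Q(f\otimes g)(\mu_{X,Y}(x,y))=\mu_{X',Y'}(Q(f)(x),Q(g)(y))$)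 and preserves all suprema in each variable separately. -}

module Defs where

open import Level using (Level; _⊔_) renaming (suc to lsuc)
open import Relation.Binary using (IsEquivalence; Poset)
open import Relation.Binary.PropositionalEquality using (_≡_; refl; trans; cong)
open import Data.Product using (Σ; _,_; proj₁; proj₂; ∃)
import Relation.Binary.Reasoning.Preorder

record Category (o ℓ e : Level) : Set (lsuc (o ⊔ ℓ ⊔ e)) where
  infixr 9 _∘_
  infix 4 _≈_
  infix 4 _⇒_
  field
    Obj       : Set o
    _⇒_       : Obj → Obj → Set ℓ
    _≈_       : ∀ {A B} → A ⇒ B → A ⇒ B → Set e
    ≈-equiv   : ∀ {A B} → IsEquivalence (_≈_ {A} {B})
    id        : ∀ {A} → A ⇒ A
    _∘_       : ∀ {A B C} → B ⇒ C → A ⇒ B → A ⇒ C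
    assoc     : ∀ {A B C D} {f : A ⇒ B} {g : B ⇒ C} {h : C ⇒ D} →
                (h ∘ g) ∘ f ≈ h ∘ (g ∘ f)
    identityˡ : ∀ {A B} {f : A ⇒ B} → id ∘ f ≈ f
    identityʳ : ∀ {A B} {f : A ⇒ B} → f ∘ id ≈ f
    ∘-resp-≈  : ∀ {A B C} {f h : B ⇒ C} {g i : A ⇒ B} →
                f ≈ h → g ≈ i → f ∘ g ≈ h ∘ i

record Functor {o ℓ e o' ℓ' e'} (C : Category o ℓ e) (D : Category o' ℓ' e')
       : Set (o ⊔ ℓ ⊔ e ⊔ o' ⊔ ℓ' ⊔ e') where
  private
    module C = Category C
    module D = Category D
  field
    F₀           : C.Obj → D.Obj
    F₁           : ∀ {A B} → A C.⇒ B → F₀ A D.⇒ F₀ B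
    identity     : ∀ {A} → F₁ (C.id {A}) D.≈ D.id
    homomorphism : ∀ {A B C} {f : A C.⇒ B} {g : B C.⇒ C} →
                   F₁ (g C.∘ f) D.≈ F₁ g D.∘ F₁ f
    F-resp-≈     : ∀ {A B} {f g : A C.⇒ B} → f C.≈ g → F₁ f D.≈ F₁ g

record SymmetricMonoidalClosed {o ℓ e} (C : Category o ℓ e) : Set (o ⊔ ℓ ⊔ e) where
  open Category C
  infixr 10 _⊗₀_ _⊗₁_
  infixr 5 _⊸_
  field
    _⊗₀_     : Obj → Obj → Obj
    _⊗₁_     : ∀ {A B C D} → A ⇒ B → C ⇒ D → A ⊗₀ C ⇒ B ⊗₀ D
    ⊗-id     : ∀ {A B} → id {A} ⊗₁ id {B} ≈ id
    ⊗-∘      : ∀ {A B C A' B' C'} {f : A ⇒ B} {g : B ⇒ C} {h : A' ⇒ B'} {k : B' ⇒ C'} →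
               (g ∘ f) ⊗₁ (k ∘ h) ≈ (g ⊗₁ k) ∘ (f ⊗₁ h)
    ⊗-resp-≈ : ∀ {A B C D} {f g : A ⇒ B} {h k : C ⇒ D} →
               f ≈ g → h ≈ k → f ⊗₁ h ≈ g ⊗₁ k
    unit     : Obj
    α        : ∀ X Y Z → (X ⊗₀ Y) ⊗₀ Z ⇒ X ⊗₀ (Y ⊗₀ Z)
    α⁻¹      : ∀ X Y Z → X ⊗₀ (Y ⊗₀ Z) ⇒ (X ⊗₀ Y) ⊗₀ Z
    λ'       : ∀ X → unit ⊗₀ X ⇒ X
    λ⁻¹      : ∀ X → X ⇒ unit ⊗₀ X
    ρ        : ∀ X → X ⊗₀ unit ⇒ X
    ρ⁻¹      : ∀ X → X ⇒ X ⊗₀ unit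
    σ        : ∀ X Y → X ⊗₀ Y ⇒ Y ⊗₀ X
    α-isoˡ   : ∀ {X Y Z} → α⁻¹ X Y Z ∘ α X Y Z ≈ id
    α-isoʳ   : ∀ {X Y Z} → α X Y Z ∘ α⁻¹ X Y Z ≈ id
    λ-isoˡ   : ∀ {X} → λ⁻¹ X ∘ λ' X ≈ id
    λ-isoʳ   : ∀ {X} → λ' X ∘ λ⁻¹ X ≈ id
    ρ-isoˡ   : ∀ {X} → ρ⁻¹ X ∘ ρ X ≈ id
    ρ-isoʳ   : ∀ {X} → ρ X ∘ ρ⁻¹ X ≈ id
    α-natural : ∀ {X X' Y Y' Z Z'} {f : X ⇒ X'} {g : Y ⇒ Y'} {h : Z ⇒ Z'} →
                α X' Y' Z' ∘ ((f ⊗₁ g) ⊗₁ h) ≈ (f ⊗₁ (g ⊗₁ h)) ∘ α X Y Z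
    λ-natural : ∀ {X Y} {f : X ⇒ Y} → λ' Y ∘ (id ⊗₁ f) ≈ f ∘ λ' X
    ρ-natural : ∀ {X Y} {f : X ⇒ Y} → ρ Y ∘ (f ⊗₁ id) ≈ f ∘ ρ X
    σ-natural : ∀ {X X' Y Y'} {f : X ⇒ X'} {g : Y ⇒ Y'} →
                σ X' Y' ∘ (f ⊗₁ g) ≈ (g ⊗₁ f) ∘ σ X Y
    triangle  : ∀ {X Y} → (id {X} ⊗₁ λ' Y) ∘ α X unit Y ≈ ρ X ⊗₁ id {Y}
    pentagon  : ∀ {W X Y Z} →
                (id {W} ⊗₁ α X Y Z) ∘ (α W (X ⊗₀ Y) Z ∘ (α W X Y ⊗₁ id {Z}))
                ≈ α W X (Y ⊗₀ Z) ∘ α (W ⊗₀ X) Y Z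
    σ-involutive : ∀ {X Y} → σ Y X ∘ σ X Y ≈ id
    hexagon   : ∀ {X Y Z} →
                α Y Z X ∘ (σ X (Y ⊗₀ Z) ∘ α X Y Z)
                ≈ (id {Y} ⊗₁ σ X Z) ∘ (α Y X Z ∘ (σ X Y ⊗₁ id {Z}))
    _⊸_      : Obj → Obj → Obj
    eval     : ∀ X Y → (X ⊸ Y) ⊗₀ X ⇒ Y
    curry    : ∀ {Z X Y} → Z ⊗₀ X ⇒ Y → Z ⇒ X ⊸ Y
    eval-curry : ∀ {Z X Y} {f : Z ⊗₀ X ⇒ Y} → eval X Y ∘ (curry f ⊗₁ id) ≈ f
    curry-unique : ∀ {Z X Y} {f : Z ⊗₀ X ⇒ Y} {g : Z ⇒ X ⊸ Y} →
                   eval X Y ∘ (g ⊗₁ id) ≈ f → g ≈ curry f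

module _ {o ℓ e o' ℓ' e'} {C : Category o ℓ e} {D : Category o' ℓ' e'}
         (S : SymmetricMonoidalClosed C) (T : SymmetricMonoidalClosed D)
         (F : Functor C D) where
  private
    module C = Category C
    module D = Category D
    module S = SymmetricMonoidalClosed S
    module T = SymmetricMonoidalClosed T
    open Functor F

  cast : ∀ {A A' B B'} → A ≡ A' → B ≡ B' → A D.⇒ B → A' D.⇒ B'
  cast refl refl f = f

  record IsStrictSMCFunctor : Set (o ⊔ ℓ ⊔ e ⊔ o' ⊔ ℓ' ⊔ e') where
    field
      F-⊗₀ : ∀ A B → F₀ (A S.⊗₀ B) ≡ F₀ A T.⊗₀ F₀ B
      F-unit : F₀ S.unit ≡ T.unit
      F-⊸ : ∀ A B → F₀ (A S.⊸ B) ≡ F₀ A T.⊸ F₀ B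
      F-⊗₁ : ∀ {A B C D} (f : A C.⇒ B) (g : C C.⇒ D) →
             cast (F-⊗₀ A C) (F-⊗₀ B D) (F₁ (f S.⊗₁ g)) D.≈ F₁ f T.⊗₁ F₁ g
      F-α : ∀ A B C →
            cast (trans (F-⊗₀ (A S.⊗₀ B) C) (cong (T._⊗₀ F₀ C) (F-⊗₀ A B)))
                 (trans (F-⊗₀ A (B S.⊗₀ C)) (cong (F₀ A T.⊗₀_) (F-⊗₀ B C)))
                 (F₁ (S.α A B C))
            D.≈ T.α (F₀ A) (F₀ B) (F₀ C)
      F-λ : ∀ A → cast (trans (F-⊗₀ S.unit A) (cong (T._⊗₀ F₀ A) F-unit)) refl
                       (F₁ (S.λ' A))
                  D.≈ T.λ' (F₀ A)
      F-ρ : ∀ A → cast (trans (F-⊗₀ A S.unit) (cong (F₀ A T.⊗₀_) F-unit)) refl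
                       (F₁ (S.ρ A))
                  D.≈ T.ρ (F₀ A)
      F-σ : ∀ A B → cast (F-⊗₀ A B) (F-⊗₀ B A) (F₁ (S.σ A B)) D.≈ T.σ (F₀ A) (F₀ B)
      -- counit (evaluation) and currying (hence the unit curry id) are preserved
      F-eval : ∀ A B → cast (trans (F-⊗₀ (A S.⊸ B) A) (cong (T._⊗₀ F₀ A) (F-⊸ A B))) refl
                            (F₁ (S.eval A B))
                       D.≈ T.eval (F₀ A) (F₀ B)
      F-curry : ∀ {Z A B} (f : Z S.⊗₀ A C.⇒ B) →
                cast refl (F-⊸ A B) (F₁ (S.curry f)) D.≈ T.curry (cast (F-⊗₀ Z A) refl (F₁ f))

record PosFunctor {o ℓ e} (C : Category o ℓ e) (c ℓ₁ ℓ₂ : Level)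
       : Set (o ⊔ ℓ ⊔ e ⊔ lsuc (c ⊔ ℓ₁ ⊔ ℓ₂)) where
  open Category C
  field
    Q₀     : Obj → Poset c ℓ₁ ℓ₂
    Q₁     : ∀ {X Y} → X ⇒ Y → Poset.Carrier (Q₀ X) → Poset.Carrier (Q₀ Y)
    Q-mono : ∀ {X Y} (f : X ⇒ Y) {x x'} → Poset._≤_ (Q₀ X) x x' →
             Poset._≤_ (Q₀ Y) (Q₁ f x) (Q₁ f x')
    Q-resp : ∀ {X Y} {f g : X ⇒ Y} → f ≈ g → ∀ x → Poset._≈_ (Q₀ Y) (Q₁ f x) (Q₁ g x)
    Q-id   : ∀ {X} x → Poset._≈_ (Q₀ X) (Q₁ (id {X}) x) x
    Q-∘    : ∀ {X Y Z} (f : X ⇒ Y) (g : Y ⇒ Z) x →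
             Poset._≈_ (Q₀ Z) (Q₁ (g ∘ f) x) (Q₁ g (Q₁ f x))

  Car : Obj → Set c
  Car X = Poset.Carrier (Q₀ X)

module _ {o ℓ e c ℓ₁ ℓ₂} {C : Category o ℓ e} (Q : PosFunctor C c ℓ₁ ℓ₂) where
  open Category C
  open PosFunctor Q

  private
    ≤-from-≈-then : ∀ {X} {a b d} → Poset._≈_ (Q₀ X) a b → Poset._≤_ (Q₀ X) b d →
                    Poset._≤_ (Q₀ X) a d
    ≤-from-≈-then {X} p q = Poset.trans (Q₀ X) (Poset.reflexive (Q₀ X) p) q

  ∫ : Category (o ⊔ c) (ℓ ⊔ ℓ₂) e
  ∫ = record
    { Obj = Σ Obj Car
    ; _⇒_ = λ A B → Σ (proj₁ A ⇒ proj₁ B)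
                      (λ f → Poset._≤_ (Q₀ (proj₁ B)) (Q₁ f (proj₂ A)) (proj₂ B))
    ; _≈_ = λ f g → proj₁ f ≈ proj₁ g
    ; ≈-equiv = record { refl = IsEquivalence.refl ≈-equiv
                       ; sym = IsEquivalence.sym ≈-equiv
                       ; trans = IsEquivalence.trans ≈-equiv }
    ; id = λ {A} → id , Poset.reflexive (Q₀ (proj₁ A)) (Q-id (proj₂ A))
    ; _∘_ = λ {A} {B} {D} g f →
              (proj₁ g ∘ proj₁ f)
            , ≤-from-≈-then (Q-∘ (proj₁ f) (proj₁ g) (proj₂ A))
                (Poset.trans (Q₀ (proj₁ D)) (Q-mono (proj₁ g) (proj₂ f)) (proj₂ g))
    ; assoc = assoc
    ; identityˡ = identityˡ
    ; identityʳ = identityʳ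
    ; ∘-resp-≈ = ∘-resp-≈
    }

  π : Functor ∫ C
  π = record
    { F₀ = proj₁
    ; F₁ = proj₁
    ; identity = IsEquivalence.refl ≈-equiv
    ; homomorphism = IsEquivalence.refl ≈-equiv
    ; F-resp-≈ = λ p → p
    }

IsSup : ∀ {c ℓ₁ ℓ₂ ι} (P : Poset c ℓ₁ ℓ₂) {I : Set ι} →
        (I → Poset.Carrier P) → Poset.Carrier P → Set (c ⊔ ℓ₂ ⊔ ι)
IsSup P {I} F s =
  Σ (∀ i → Poset._≤_ P (F i) s)
    (λ _ → ∀ b → (∀ i → Poset._≤_ P (F i) b) → Poset._≤_ P s b)

module _ {o ℓ e c ℓ₁ ℓ₂} {C : Category o ℓ e} (S : SymmetricMonoidalClosed C)
         (Q : PosFunctor C c ℓ₁ ℓ₂) where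
  open Category C using (Obj; _⇒_)
  open SymmetricMonoidalClosed S
  open PosFunctor Q

  private
    _≈Q_ : ∀ {X} → Car X → Car X → Set ℓ₁
    _≈Q_ {X} = Poset._≈_ (Q₀ X)

  record MonoidalData : Set (o ⊔ c ⊔ ℓ₁) where
    field
      u   : Car unit
      μ   : ∀ X Y → Car X → Car Y → Car (X ⊗₀ Y)
      μ-λ : ∀ {Y} (y : Car Y) → Q₁ (λ' Y) (μ unit Y u y) ≈Q y
      μ-ρ : ∀ {X} (x : Car X) → Q₁ (ρ X) (μ X unit x u) ≈Q x
      μ-α : ∀ {X Y Z} (x : Car X) (y : Car Y) (z : Car Z) →
            Q₁ (α X Y Z) (μ (X ⊗₀ Y) Z (μ X Y x y) z) ≈Q μ X (Y ⊗₀ Z) x (μ Y Z y z)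
      μ-σ : ∀ {X Y} (x : Car X) (y : Car Y) →
            Q₁ (σ X Y) (μ X Y x y) ≈Q μ Y X y x

  record FactorsThroughSLatt (M : MonoidalData) : Set (o ⊔ ℓ ⊔ lsuc (c ⊔ ℓ₁ ⊔ ℓ₂)) where
    open MonoidalData M
    field
      complete   : ∀ X (I : Set (c ⊔ ℓ₁ ⊔ ℓ₂)) (F : I → Car X) → ∃ λ s → IsSup (Q₀ X) F s
      Q₁-sup     : ∀ {X Y} (f : X ⇒ Y) (I : Set (c ⊔ ℓ₁ ⊔ ℓ₂)) (F : I → Car X) (s : Car X) →
                   IsSup (Q₀ X) F s → IsSup (Q₀ Y) (λ i → Q₁ f (F i)) (Q₁ f s)
      μ-natural  : ∀ {X X' Y Y'} (f : X ⇒ X') (g : Y ⇒ Y') (x : Car X) (y : Car Y) →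
                   Q₁ (f ⊗₁ g) (μ X Y x y) ≈Q μ X' Y' (Q₁ f x) (Q₁ g y)
      μ-supˡ     : ∀ {X Y} (I : Set (c ⊔ ℓ₁ ⊔ ℓ₂)) (F : I → Car X) (s : Car X) (y : Car Y) →
                   IsSup (Q₀ X) F s → IsSup (Q₀ (X ⊗₀ Y)) (λ i → μ X Y (F i) y) (μ X Y s y)
      μ-supʳ     : ∀ {X Y} (I : Set (c ⊔ ℓ₁ ⊔ ℓ₂)) (x : Car X) (F : I → Car Y) (s : Car Y) →
                   IsSup (Q₀ Y) F s → IsSup (Q₀ (X ⊗₀ Y)) (λ i → μ X Y x (F i)) (μ X Y x s)

  ∫⊗₀ : MonoidalData → Category.Obj (∫ Q) → Category.Obj (∫ Q) → Category.Obj (∫ Q)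
  ∫⊗₀ M (X , x) (Y , y) = (X ⊗₀ Y) , MonoidalData.μ M X Y x y

  ∫unit : MonoidalData → Category.Obj (∫ Q)
  ∫unit M = unit , MonoidalData.u M

-- Arrows of ∫Q are arrows of C with a property, compared as arrows of C; so once the
-- structure maps of C lift, every axiom is inherited and π preserves everything on the nose.
-- The tensor lifts because μ is natural and monotone, the coherence isomorphisms because μ
-- satisfies the coherence equations exactly. For the internal hom, weight X ⊸ Y by the
-- supremum of all k with Q(ev)(μ(k, x)) ≤ y. Since k ↦ Q(ev)(μ(k, x)) preserves suprema,
-- this supremum is itself such a k, so ev lifts; and every curried arrow lands below it.
module Submission where

open import Defs
open import Data.Bool using (Bool; true; false)
open import Data.Product using (Σ; _×_; _,_; proj₁; proj₂)
open import Function using (_∘′_)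
open import Level using (Level; _⊔_; Lift; lift; lower)
open import Relation.Binary using (Poset; IsEquivalence)
open import Relation.Binary.PropositionalEquality using (_≡_; refl)
import Relation.Binary.Reasoning.PartialOrder as PosetReasoning

module _ {c ℓ₁ ℓ₂} (P : Poset c ℓ₁ ℓ₂) where
  open Poset P hiding (refl)

  sup-upper : ∀ {ι} {I : Set ι} {F : I → Carrier} {s} → IsSup P F s → ∀ i → F i ≤ s
  sup-upper = proj₁

  sup-least : ∀ {ι} {I : Set ι} {F : I → Carrier} {s} → IsSup P F s →
              ∀ b → (∀ i → F i ≤ b) → s ≤ b
  sup-least = proj₂

  pair : ∀ {ι} → Carrier → Carrier → Lift ι Bool → Carrier
  pair a b (lift true)  = a
  pair a b (lift false) = b

  pair-isSup : ∀ {ι a b} → a ≤ b → IsSup P (pair {ι} a b) b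
  pair-isSup a≤b = (λ { (lift true) → a≤b ; (lift false) → Poset.refl P }) , λ _ ub → ub (lift false)

module _ {c ℓ₁ ℓ₂ c′ ℓ₁′ ℓ₂′} (P : Poset c ℓ₁ ℓ₂) (R : Poset c′ ℓ₁′ ℓ₂′) where
  private
    module P = Poset P
    module R = Poset R

  PreservesSups : ∀ ι → (P.Carrier → R.Carrier) → Set (c ⊔ ℓ₂ ⊔ c′ ⊔ ℓ₂′ ⊔ Level.suc ι)
  PreservesSups ι f = ∀ {I : Set ι} (F : I → P.Carrier) s → IsSup P F s → IsSup R (f ∘′ F) (f s)

  preservesSups⇒monotone : ∀ {ι} {f : P.Carrier → R.Carrier} → PreservesSups ι f →
                           ∀ {a b} → a P.≤ b → f a R.≤ f b
  preservesSups⇒monotone preserves {a} {b} a≤b =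
    sup-upper R (preserves (pair P a b) b (pair-isSup P a≤b)) (lift true)

module Fibres {o ℓ e c ℓ₁ ℓ₂} {C : Category o ℓ e} (Q : PosFunctor C c ℓ₁ ℓ₂) where
  open Category C
  open PosFunctor Q
  open Category (∫ Q) using () renaming (_⇒_ to _⇒∫_)

  Fibre≤ : ∀ X → Car X → Car X → Set ℓ₂
  Fibre≤ X = Poset._≤_ (Q₀ X)

  Fibre≈ : ∀ X → Car X → Car X → Set ℓ₁
  Fibre≈ X = Poset._≈_ (Q₀ X)

  infix 4 Fibre≤ Fibre≈
  syntax Fibre≤ X a b = a ≤[ X ] b
  syntax Fibre≈ X a b = a ≈[ X ] b

  Q₁-retraction : ∀ {X Y} {f : X ⇒ Y} {g : Y ⇒ X} → g ∘ f ≈ id →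
                  ∀ x → Q₁ g (Q₁ f x) ≈[ X ] x
  Q₁-retraction {X} {f = f} {g} g∘f≈id x = begin-equality
    Q₁ g (Q₁ f x)  ≈⟨ Q-∘ f g x ⟨
    Q₁ (g ∘ f) x   ≈⟨ Q-resp g∘f≈id x ⟩
    Q₁ id x        ≈⟨ Q-id x ⟩
    x              ∎
    where open PosetReasoning (Q₀ X)

  tight-arrow : ∀ {X Y x y} (f : X ⇒ Y) → Q₁ f x ≈[ Y ] y → (X , x) ⇒∫ (Y , y)
  tight-arrow {Y = Y} f fx≈y = f , Poset.reflexive (Q₀ Y) fx≈y

  retraction-arrow : ∀ {X Y x y} (f : X ⇒ Y) (g : Y ⇒ X) → g ∘ f ≈ id →
                     Q₁ f x ≈[ Y ] y → (Y , y) ⇒∫ (X , x)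
  retraction-arrow {X} {Y} {x} {y} f g g∘f≈id fx≈y = g , (begin
    Q₁ g y          ≤⟨ Q-mono g (Poset.reflexive (Q₀ Y) (Poset.Eq.sym (Q₀ Y) fx≈y)) ⟩
    Q₁ g (Q₁ f x)   ≈⟨ Q₁-retraction g∘f≈id x ⟩
    x               ∎)
    where open PosetReasoning (Q₀ X)

module Lifted {o ℓ e c ℓ₁ ℓ₂} {C : Category o ℓ e}
    (S : SymmetricMonoidalClosed C) (Q : PosFunctor C c ℓ₁ ℓ₂)
    (M : MonoidalData S Q) (F : FactorsThroughSLatt S Q M) where
  open Category C
  open SymmetricMonoidalClosed S
  open PosFunctor Q
  open MonoidalData M
  open FactorsThroughSLatt F
  open Fibres Q
  open Category (∫ Q) using () renaming (Obj to Obj∫; _⇒_ to _⇒∫_)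

  μ-mono : ∀ {X Y} {x x′ : Car X} {y y′ : Car Y} → x ≤[ X ] x′ → y ≤[ Y ] y′ →
           μ X Y x y ≤[ X ⊗₀ Y ] μ X Y x′ y′
  μ-mono {X} {Y} {x} {x′} {y} {y′} x≤x′ y≤y′ = begin
    μ X Y x y    ≤⟨ preservesSups⇒monotone (Q₀ X) (Q₀ (X ⊗₀ Y))
                      (λ G s → μ-supˡ _ G s y) x≤x′ ⟩
    μ X Y x′ y   ≤⟨ preservesSups⇒monotone (Q₀ Y) (Q₀ (X ⊗₀ Y))
                      (λ G s → μ-supʳ _ x′ G s) y≤y′ ⟩
    μ X Y x′ y′  ∎
    where open PosetReasoning (Q₀ (X ⊗₀ Y))

  _⊗∫₀_ : Obj∫ → Obj∫ → Obj∫
  _⊗∫₀_ = ∫⊗₀ S Q M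

  _⊗∫₁_ : ∀ {A B A′ B′} → A ⇒∫ B → A′ ⇒∫ B′ → A ⊗∫₀ A′ ⇒∫ B ⊗∫₀ B′
  _⊗∫₁_ {X , x} {X′ , x′} {Y , y} {Y′ , y′} (f , fx≤x′) (g , gy≤y′) = f ⊗₁ g , (begin
    Q₁ (f ⊗₁ g) (μ X Y x y)      ≈⟨ μ-natural f g x y ⟩
    μ X′ Y′ (Q₁ f x) (Q₁ g y)    ≤⟨ μ-mono fx≤x′ gy≤y′ ⟩
    μ X′ Y′ x′ y′                ∎)
    where open PosetReasoning (Q₀ (X′ ⊗₀ Y′))

  IsAdmissible : ∀ A B → Car (proj₁ A ⊸ proj₁ B) → Set ℓ₂
  IsAdmissible (X , x) (Y , y) k = Q₁ (eval X Y) (μ (X ⊸ Y) X k x) ≤[ Y ] y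

  -- Lifted because completeness of the fibres is only assumed at level c ⊔ ℓ₁ ⊔ ℓ₂.
  admissibleWeight : ∀ A B → Lift (c ⊔ ℓ₁ ⊔ ℓ₂) (Σ _ (IsAdmissible A B)) → Car (proj₁ A ⊸ proj₁ B)
  admissibleWeight A B = proj₁ ∘′ lower

  _⊸∫_ : Obj∫ → Obj∫ → Obj∫
  A ⊸∫ B = (proj₁ A ⊸ proj₁ B) , proj₁ (complete _ _ (admissibleWeight A B))

  ⊸∫-isSup : ∀ A B → IsSup (Q₀ (proj₁ A ⊸ proj₁ B)) (admissibleWeight A B) (proj₂ (A ⊸∫ B))
  ⊸∫-isSup A B = proj₂ (complete _ _ (admissibleWeight A B))

  ⊸∫-isAdmissible : ∀ A B → IsAdmissible A B (proj₂ (A ⊸∫ B))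
  ⊸∫-isAdmissible A@(X , x) B@(Y , y) =
    sup-least (Q₀ Y) (Q₁-sup (eval X Y) _ _ _ (μ-supˡ _ _ _ x (⊸∫-isSup A B)))
      y (λ i → proj₂ (lower i))

  eval∫ : ∀ A B → (A ⊸∫ B) ⊗∫₀ A ⇒∫ B
  eval∫ A B = eval (proj₁ A) (proj₁ B) , ⊸∫-isAdmissible A B

  curry-isAdmissible : ∀ {Z X Y} (f : Z ⊗₀ X ⇒ Y) z x y → Q₁ f (μ Z X z x) ≤[ Y ] y →
                       IsAdmissible (X , x) (Y , y) (Q₁ (curry f) z)
  curry-isAdmissible {Z} {X} {Y} f z x y f-weight = begin
    Q₁ (eval X Y) (μ (X ⊸ Y) X (Q₁ (curry f) z) x)
      ≤⟨ Q-mono (eval X Y) (μ-mono (Poset.refl (Q₀ (X ⊸ Y)))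
                                   (Poset.reflexive (Q₀ X) (Poset.Eq.sym (Q₀ X) (Q-id x)))) ⟩
    Q₁ (eval X Y) (μ (X ⊸ Y) X (Q₁ (curry f) z) (Q₁ id x))
      ≤⟨ Q-mono (eval X Y) (Poset.reflexive (Q₀ ((X ⊸ Y) ⊗₀ X))
                              (Poset.Eq.sym (Q₀ ((X ⊸ Y) ⊗₀ X)) (μ-natural (curry f) id z x))) ⟩
    Q₁ (eval X Y) (Q₁ (curry f ⊗₁ id) (μ Z X z x))
      ≈⟨ Q-∘ (curry f ⊗₁ id) (eval X Y) _ ⟨
    Q₁ (eval X Y ∘ (curry f ⊗₁ id)) (μ Z X z x)
      ≈⟨ Q-resp eval-curry _ ⟩
    Q₁ f (μ Z X z x)
      ≤⟨ f-weight ⟩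
    y ∎
    where open PosetReasoning (Q₀ Y)

  curry∫ : ∀ {D A B} → D ⊗∫₀ A ⇒∫ B → D ⇒∫ A ⊸∫ B
  curry∫ {Z , z} {A@(X , x)} {B@(Y , y)} (f , f-weight) = curry f ,
    sup-upper (Q₀ (X ⊸ Y)) (⊸∫-isSup A B)
      (lift (Q₁ (curry f) z , curry-isAdmissible f z x y f-weight))

  ∫SMC : SymmetricMonoidalClosed (∫ Q)
  ∫SMC = record
    { _⊗₀_         = _⊗∫₀_
    ; _⊗₁_         = _⊗∫₁_
    ; ⊗-id         = ⊗-id
    ; ⊗-∘          = ⊗-∘
    ; ⊗-resp-≈     = ⊗-resp-≈
    ; unit         = ∫unit S Q M
    ; α            = λ { (X , x) (Y , y) (Z , z) → tight-arrow (α X Y Z) (μ-α x y z) }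
    ; α⁻¹          = λ { (X , x) (Y , y) (Z , z) →
                         retraction-arrow (α X Y Z) (α⁻¹ X Y Z) α-isoˡ (μ-α x y z) }
    ; λ'           = λ { (X , x) → tight-arrow (λ' X) (μ-λ x) }
    ; λ⁻¹          = λ { (X , x) → retraction-arrow (λ' X) (λ⁻¹ X) λ-isoˡ (μ-λ x) }
    ; ρ            = λ { (X , x) → tight-arrow (ρ X) (μ-ρ x) }
    ; ρ⁻¹          = λ { (X , x) → retraction-arrow (ρ X) (ρ⁻¹ X) ρ-isoˡ (μ-ρ x) }
    ; σ            = λ { (X , x) (Y , y) → tight-arrow (σ X Y) (μ-σ x y) }
    ; α-isoˡ       = α-isoˡ
    ; α-isoʳ       = α-isoʳ
    ; λ-isoˡ       = λ-isoˡ
    ; λ-isoʳ       = λ-isoʳ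
    ; ρ-isoˡ       = ρ-isoˡ
    ; ρ-isoʳ       = ρ-isoʳ
    ; α-natural    = α-natural
    ; λ-natural    = λ-natural
    ; ρ-natural    = ρ-natural
    ; σ-natural    = σ-natural
    ; triangle     = triangle
    ; pentagon     = pentagon
    ; σ-involutive = σ-involutive
    ; hexagon      = hexagon
    ; _⊸_          = _⊸∫_
    ; eval         = eval∫
    ; curry        = curry∫
    ; eval-curry   = eval-curry
    ; curry-unique = curry-unique
    }

  π-strict : IsStrictSMCFunctor ∫SMC S (π Q)
  π-strict = record
    { F-⊗₀    = λ _ _ → refl
    ; F-unit  = refl
    ; F-⊸     = λ _ _ → refl
    ; F-⊗₁    = λ _ _ → ≈-refl
    ; F-α     = λ _ _ _ → ≈-refl
    ; F-λ     = λ _ → ≈-refl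
    ; F-ρ     = λ _ → ≈-refl
    ; F-σ     = λ _ _ → ≈-refl
    ; F-eval  = λ _ _ → ≈-refl
    ; F-curry = λ _ → ≈-refl
    }
    where
      ≈-refl : ∀ {A B} {f : A ⇒ B} → f ≈ f
      ≈-refl = IsEquivalence.refl ≈-equiv

mainTheorem4 : ∀ {o ℓ e c ℓ₁ ℓ₂} {C : Category o ℓ e}
    (S : SymmetricMonoidalClosed C) (Q : PosFunctor C c ℓ₁ ℓ₂)
    (M : MonoidalData S Q) → FactorsThroughSLatt S Q M →
    Σ (SymmetricMonoidalClosed (∫ Q)) (λ T →
      (∀ A B → SymmetricMonoidalClosed._⊗₀_ T A B ≡ ∫⊗₀ S Q M A B)
      × (SymmetricMonoidalClosed.unit T ≡ ∫unit S Q M)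
      × IsStrictSMCFunctor T S (π Q))
mainTheorem4 S Q M F = ∫SMC , (λ _ _ → refl) , refl , π-strict
  where open Lifted S Q M F
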